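{- Let $F$ be a forest, and let $G$, $R$, $\beta$ and the notion of $\beta$-matching be as described in the context. Then every $\beta$-matching is a maximum matching of $G$.
   Context: For a forest $F$, $\mathcal{N}(F)$ is the null space of its adjacency matrix (functions $z:V(F)\to\mathbb{R}$ with $\sum_{y\in N_F(x)}z(y)=0$ for all $x$). $S$ is the set of vertices $x$ of $F$ with $z(x)\neq 0$ for some $z\in\mathcal{N}(F)$. $G$ is the forest whose edges are the edges of $F$ having at least one endpoint in $S$ and whose vertices are the endpoints of those edges. $R=V(G)\setminus S$. Each component of $G$ is rooted at some (arbitrarily chosen) vertex of $S$; $\kappa(x)$ denotes the set of children and $\pi(x)$ the parent of $x$ (every vertex of $R$ has at least one child). Define $\overline{\beta}:V(G)\to\mathbb{N}$ recursively by $\overline{\beta}(x)=\min_{c\in\kappa(x)}\overline{\beta}(c)$ if $x\in R$ and $\overline{\beta}(x)=1+\sum_{c\in\kappa(x)}\overline{\beta}(c)$ if $x\in S$. Define $\beta:V(G)\to\mathbb{N}$ by $\beta(x)=\min\{\overline{\beta}(x),\,\beta(\pi(x))-\overline{\beta}(x)\}$ if $x\in R$ and $\beta(x)=\overline{\beta}(x)+\beta(\pi(x))$ if $x\in S$, with $\beta(\pi(x))=0$ if $x$ has no parent. For $x\in R$, a $\beta$-minimizer for $x$ is a neighbor $y$ of $x$ in $G$ such that either $y\in\kappa(x)$ and $\beta(x)=\overline{\beta}(y)$, or $y=\pi(x)$ and $\beta(x)=\beta(\pi(x))-\overline{\beta}(x)$. A $\beta$-matching is any set of edges $\{r\phi(r)\colon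 r\in R\}$ where, for each $r\in R$, $\phi(r)$ is a $\beta$-minimizer for $r$.
   Formalization: The null space $\mathcal{N}(F)$ defining S is taken over ℚ instead of ℝ. -}

module Defs where

open import Data.Nat using (ℕ; zero; suc; _+_; _≤_; _⊓_; _∸_)
open import Data.Fin using (Fin; _≟_)
open import Data.Bool using (Bool; true; false; if_then_else_)
open import Data.List using (List; []; _∷_; _++_; [_]; map; foldr; length; concatMap)
open import Data.List.Relation.Unary.All using (All)
open import Data.List.Relation.Unary.Linked using (Linked)
open import Data.List.Relation.Unary.Unique.Propositional using (Unique)
open import Data.Vec.Functional using () renaming (foldr to foldrF)
open import Data.Maybe using (Maybe; just; nothing)
open import Data.Product using (Σ; ∃; _×_; _,_)
open import Data.Sum using (_⊎_)
open import Relation.Nullary using (¬_; does)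
open import Relation.Binary.PropositionalEquality using (_≡_; _≢_)
import Data.Rational as ℚ
open ℚ using (ℚ; 0ℚ)

AdjMat : ℕ → Set
AdjMat n = Fin n → Fin n → Bool

Adj : ∀ {n} → AdjMat n → Fin n → Fin n → Set
Adj A x y = A x y ≡ true

Σℚ : ∀ {n} → (Fin n → ℚ) → ℚ
Σℚ f = foldrF ℚ._+_ 0ℚ f

Σℕ : ∀ {n} → (Fin n → ℕ) → ℕ
Σℕ f = foldrF _+_ 0 f

IsCycle : ∀ {n} → AdjMat n → Fin n → List (Fin n) → Set
IsCycle A x vs = (2 ≤ length vs) × Unique (x ∷ vs) × Linked (Adj A) (x ∷ vs ++ [ x ])

record IsForest {n : ℕ} (A : AdjMat n) : Set where
  field
    symmetric  : ∀ x y → A x y ≡ A y x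
    irreflexive : ∀ x → A x x ≡ false
    acyclic    : ∀ x vs → ¬ IsCycle A x vs

InNullSpace : ∀ {n} → AdjMat n → (Fin n → ℚ) → Set
InNullSpace A z = ∀ x → Σℚ (λ y → if A x y then z y else 0ℚ) ≡ 0ℚ

InS : ∀ {n} → AdjMat n → Fin n → Set
InS A x = ∃ λ z → InNullSpace A z × z x ≢ 0ℚ

GEdge : ∀ {n} → AdjMat n → Fin n → Fin n → Set
GEdge A x y = Adj A x y × (InS A x ⊎ InS A y)

InVG : ∀ {n} → AdjMat n → Fin n → Set
InVG A x = ∃ λ y → GEdge A x y

InR : ∀ {n} → AdjMat n → Fin n → Set
InR A x = InVG A x × ¬ InS A x

-- A rooting of every component of G at a vertex of S, given by a parent
-- function and a depth function (parent is one step shallower).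
record Rooting {n : ℕ} (A : AdjMat n) : Set where
  field
    parent : Fin n → Maybe (Fin n)
    depth  : Fin n → ℕ
    parent-edge  : ∀ x p → parent x ≡ just p → GEdge A x p
    parent-depth : ∀ x p → parent x ≡ just p → depth x ≡ suc (depth p)
    edge-parent  : ∀ x y → GEdge A x y → parent x ≡ just y ⊎ parent y ≡ just x
    root-in-S    : ∀ x → InVG A x → parent x ≡ nothing → InS A x

module _ {n : ℕ} {A : AdjMat n} (ρ : Rooting A) where
  open Rooting ρ

  Child : Fin n → Fin n → Set
  Child x c = parent c ≡ just x

  isChild : Fin n → Fin n → Bool
  isChild x c with parent c
  ... | nothing = false
  ... | just p  = does (p ≟ x)

  -- β(π(x)), with the convention 0 if x has no parent
  parentVal : (Fin n → ℕ) → Fin n → ℕ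
  parentVal f x with parent x
  ... | nothing = 0
  ... | just p  = f p

  IsBetaBar : (Fin n → ℕ) → Set
  IsBetaBar bb =
    (∀ x → InR A x → (∃ λ c → Child x c × bb x ≡ bb c) × (∀ c → Child x c → bb x ≤ bb c))
    × (∀ x → InVG A x → InS A x → bb x ≡ suc (Σℕ (λ c → if isChild x c then bb c else 0)))

  IsBeta : (Fin n → ℕ) → (Fin n → ℕ) → Set
  IsBeta bb b =
    (∀ x → InR A x → b x ≡ bb x ⊓ (parentVal b x ∸ bb x))
    × (∀ x → InVG A x → InS A x → b x ≡ bb x + parentVal b x)

  BetaMinimizer : (Fin n → ℕ) → (Fin n → ℕ) → Fin n → Fin n → Set
  BetaMinimizer bb b x y =
    (Child x y × b x ≡ bb y) ⊎ (parent x ≡ just y × b x ≡ b y ∸ bb x)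

endpoints : ∀ {n} → List (Fin n × Fin n) → List (Fin n)
endpoints = concatMap (λ { (u , v) → u ∷ v ∷ [] })

IsMatching : ∀ {n} → AdjMat n → List (Fin n × Fin n) → Set
IsMatching A M = All (λ { (u , v) → GEdge A u v }) M × Unique (endpoints M)

IsMaximumMatching : ∀ {n} → AdjMat n → List (Fin n × Fin n) → Set
IsMaximumMatching A M =
  IsMatching A M × (∀ M′ → IsMatching A M′ → length M′ ≤ length M)

{-# OPTIONS --safe #-}
module Submission where

-- Every edge of G has an endpoint in S, and no two vertices of S are adjacent, so R is a vertex
-- cover of G and no matching of G has more than |R| edges; a β-matching has exactly |R| edges.
--
-- Independence of S: let y be the parent of x, z(x) ≠ 0 and w(y) ≠ 0 for null vectors z, w, and
-- T the subtree of x. Since null vectors vanish off S, the only edge out of T carrying weight is xy,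
-- so the flux Σ_{u ∈ T} w(u) Σ_{v ∉ T, v ~ u} f(v) equals w(x) f(y) for every null f. For null w, f
-- the flux is symmetric in w and f (A is symmetric), whence z(x) w(y) = w(x) z(y). Replacing z by its
-- restriction to the depth-parity class of x, which is still null, makes the right-hand side vanish.
--
-- Distinct endpoints: φ maps R into S, and injectively, because a child c of s with β-minimizer s
-- has β(s) ≤ 2 β̄(c), while β(s) ≥ β̄(s) exceeds the sum of β̄ over the children of s, and
-- β(s) = 2 β̄(s) if s is the β-minimizer of its parent.

open import Defs
open import Data.List using (List; []; _∷_; map; length)
open import Data.List.Relation.Unary.Unique.Propositional using (Unique)
open import Data.List.Membership.Propositional using (_∈_)
open import Data.Product using (_×_; _,_; proj₁; proj₂)
open import Function.Bundles using (_⇔_; Equivalence)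

open import Algebra.Bundles using (CommutativeRing)
import Algebra.Properties.CommutativeMonoid.Sum as MonoidSum
import Algebra.Properties.Group as GroupProperties
import Algebra.Properties.Semiring.Sum as SemiringSum
open import Data.Bool using (Bool; true; false; not; _∨_; _xor_; if_then_else_)
open import Data.Bool.Properties using (not-involutive; not-distribˡ-xor; xor-same; if-eta; ∨-zeroʳ)
open import Data.Empty using (⊥; ⊥-elim)
open import Data.Fin using (Fin; punchIn; punchOut; _≟_)
open import Data.Fin.Properties using (punchInᵢ≢i; punchIn-punchOut)
import Data.List.Fresh as Fresh
import Data.List.Fresh.Membership.Setoid.Properties as FreshMembership
import Data.List.Fresh.Relation.Unary.Any as FreshAny
open import Data.List.Membership.DecPropositional using () renaming (_∈?_ to member?)
open import Data.List.Properties using (length-map)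
open import Data.List.Relation.Unary.All using (All; []; _∷_)
import Data.List.Relation.Unary.All as All
import Data.List.Relation.Unary.All.Properties as All
open import Data.List.Relation.Unary.AllPairs using ([]; _∷_)
open import Data.List.Relation.Unary.Any using (here; there)
open import Data.Maybe using (just; maybe)
open import Data.Maybe.Properties using (just-injective)
open import Data.Nat using (ℕ; zero; suc; _+_; _≤_; _<_; _∸_; s≤s)
open import Data.Nat.Properties as ℕ using (module ≤-Reasoning)
open import Data.Rational using (ℚ; 0ℚ; 1ℚ; _*_; 1/_; NonZero; ≢-nonZero) renaming (_+_ to _+ℚ_; _≟_ to _≟ℚ_)
import Data.Rational.Properties as ℚ
open import Data.Sum using (_⊎_; inj₁; inj₂; [_,_])
import Data.Sum as Sum
open import Function using (_∘_)
open import Relation.Binary.PropositionalEquality hiding ([_])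
open import Relation.Nullary using (yes; no; does; contradiction)
open import Relation.Nullary.Decidable using (dec-true; dec-false; decidable-stable)

private
  module ℚΣ = SemiringSum (CommutativeRing.semiring ℚ.+-*-commutativeRing)
  module ℕΣ = MonoidSum ℕ.+-0-commutativeMonoid

Σℚ-zero : ∀ {n} {f : Fin n → ℚ} → (∀ i → f i ≡ 0ℚ) → Σℚ f ≡ 0ℚ
Σℚ-zero {n} f≡0 = trans (ℚΣ.sum-cong-≗ f≡0) (ℚΣ.sum-replicate-zero n)

Σℚ-supported : ∀ {n} (f : Fin n → ℚ) i → (∀ j → f j ≢ 0ℚ → j ≡ i) → Σℚ f ≡ f i
Σℚ-supported {suc n} f i supp = begin
  Σℚ f                      ≡⟨ ℚΣ.sum-remove {i = i} f ⟩
  f i +ℚ Σℚ (f ∘ punchIn i) ≡⟨ cong (f i +ℚ_) (Σℚ-zero off-i) ⟩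
  f i +ℚ 0ℚ                 ≡⟨ ℚ.+-identityʳ (f i) ⟩
  f i                       ∎
  where
  open ≡-Reasoning
  off-i : ∀ k → f (punchIn i k) ≡ 0ℚ
  off-i k = decidable-stable (f (punchIn i k) ≟ℚ 0ℚ) (punchInᵢ≢i i k ∘ supp (punchIn i k))

≤-Σℕ : ∀ {n} (f : Fin n → ℕ) i → f i ≤ Σℕ f
≤-Σℕ {suc n} f i = ℕ.≤-trans (ℕ.m≤m+n (f i) _) (ℕ.≤-reflexive (sym (ℕΣ.sum-remove {i = i} f)))

+-≤-Σℕ : ∀ {n} (f : Fin n → ℕ) {i j} → i ≢ j → f i + f j ≤ Σℕ f
+-≤-Σℕ {suc n} f {i} {j} i≢j = begin
  f i + f j                          ≡⟨ cong (λ k → f i + f k) (sym (punchIn-punchOut i≢j)) ⟩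
  f i + f (punchIn i (punchOut i≢j)) ≤⟨ ℕ.+-monoʳ-≤ (f i) (≤-Σℕ (f ∘ punchIn i) (punchOut i≢j)) ⟩
  f i + Σℕ (f ∘ punchIn i)           ≡⟨ sym (ℕΣ.sum-remove {i = i} f) ⟩
  Σℕ f                               ∎
  where open ≤-Reasoning

*-≢0 : ∀ {p q} → p ≢ 0ℚ → q ≢ 0ℚ → p * q ≢ 0ℚ
*-≢0 {p} {q} p≢0 q≢0 pq≡0 = q≢0 (begin
  q               ≡⟨ sym (ℚ.*-identityˡ q) ⟩
  1ℚ * q          ≡⟨ cong (_* q) (sym (ℚ.*-inverseˡ p)) ⟩
  (1/ p * p) * q  ≡⟨ ℚ.*-assoc (1/ p) p q ⟩
  1/ p * (p * q)  ≡⟨ cong (1/ p *_) pq≡0 ⟩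
  1/ p * 0ℚ       ≡⟨ ℚ.*-zeroʳ (1/ p) ⟩
  0ℚ              ∎)
  where
  open ≡-Reasoning
  instance
    p-nonZero : NonZero p
    p-nonZero = ≢-nonZero p≢0

m∸n≤n⇒m≤n+n : ∀ {m n} → m ∸ n ≤ n → m ≤ n + n
m∸n≤n⇒m≤n+n {m} {n} m∸n≤n = ℕ.≤-trans (ℕ.m≤n+m∸n m n) (ℕ.+-monoʳ-≤ n m∸n≤n)

-- InNullSpace A z unfolds to ∀ x → Σℚ (restrict (A x) z) ≡ 0ℚ.
restrict : ∀ {n} → (Fin n → Bool) → (Fin n → ℚ) → Fin n → ℚ
restrict P f u = if P u then f u else 0ℚ

restrict-split : ∀ {n} (P T : Fin n → Bool) (f : Fin n → ℚ) u →
                 restrict P (restrict T f) u +ℚ restrict P (restrict (not ∘ T) f) u ≡ restrict P f u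
restrict-split P T f u with P u | T u
... | false | _     = ℚ.+-identityˡ 0ℚ
... | true  | true  = ℚ.+-identityʳ (f u)
... | true  | false = ℚ.+-identityˡ (f u)

restrict-colouring-null : ∀ {n} {A : AdjMat n} (c : Fin n → Bool) → (∀ {u v} → GEdge A u v → c v ≡ not (c u)) →
                          ∀ {f} → InNullSpace A f → InNullSpace A (restrict c f)
restrict-colouring-null {n} {A} c c-proper {f} f-null u =
  trans (ℚΣ.sum-cong-≗ row-term) (row (not (c u)))
  where
  row-term : ∀ v → restrict (A u) (restrict c f) v ≡ (if not (c u) then restrict (A u) f v else 0ℚ)
  row-term v with A u v in uv | f v ≟ℚ 0ℚ
  ... | false | _        = sym (if-eta (not (c u)))
  ... | true  | yes fv≡0 rewrite fv≡0 = trans (if-eta (c v)) (sym (if-eta (not (c u))))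
  ... | true  | no fv≢0  rewrite c-proper (uv , inj₂ (f , f-null , fv≢0)) = refl
  row : ∀ b → Σℚ (λ v → if b then restrict (A u) f v else 0ℚ) ≡ 0ℚ
  row true  = f-null u
  row false = ℚΣ.sum-replicate-zero n

module _ {n : ℕ} (A : AdjMat n) where

  inflow outflow : (Fin n → Bool) → (Fin n → ℚ) → Fin n → ℚ
  inflow  T f u = Σℚ (restrict (A u) (restrict T f))
  outflow T f u = Σℚ (restrict (A u) (restrict (not ∘ T) f))

  interior flux : (Fin n → Bool) → (Fin n → ℚ) → (Fin n → ℚ) → ℚ
  interior T w f = Σℚ (λ u → restrict T w u * inflow T f u)
  flux     T w f = Σℚ (λ u → restrict T w u * outflow T f u)

  inflow+outflow : ∀ T f u → inflow T f u +ℚ outflow T f u ≡ Σℚ (restrict (A u) f)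
  inflow+outflow T f u =
    trans (sym (ℚΣ.∑-distrib-+ (restrict (A u) (restrict T f)) (restrict (A u) (restrict (not ∘ T) f))))
          (ℚΣ.sum-cong-≗ (restrict-split (A u) T f))

  interior+flux : ∀ T w {f} → InNullSpace A f → interior T w f +ℚ flux T w f ≡ 0ℚ
  interior+flux T w {f} f-null = trans (sym (ℚΣ.∑-distrib-+ inner outer)) (Σℚ-zero (λ u → begin
    restrict T w u * inflow T f u +ℚ restrict T w u * outflow T f u
      ≡⟨ sym (ℚ.*-distribˡ-+ (restrict T w u) _ _) ⟩
    restrict T w u * (inflow T f u +ℚ outflow T f u)
      ≡⟨ cong (restrict T w u *_) (trans (inflow+outflow T f u) (f-null u)) ⟩
    restrict T w u * 0ℚ
      ≡⟨ ℚ.*-zeroʳ (restrict T w u) ⟩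
    0ℚ ∎))
    where
    open ≡-Reasoning
    inner outer : Fin n → ℚ
    inner u = restrict T w u * inflow T f u
    outer u = restrict T w u * outflow T f u

  module _ (A-sym : ∀ u v → A u v ≡ A v u) where

    edge-term-comm : ∀ T (w f : Fin n → ℚ) u v →
      restrict T w u * restrict (A u) (restrict T f) v ≡ restrict T f v * restrict (A v) (restrict T w) u
    edge-term-comm T w f u v rewrite A-sym v u with T u | T v | A u v
    ... | true  | true  | true  = ℚ.*-comm (w u) (f v)
    ... | tu    | tv    | false =
      trans (ℚ.*-zeroʳ (if tu then w u else 0ℚ)) (sym (ℚ.*-zeroʳ (if tv then f v else 0ℚ)))
    ... | false | true  | true  = trans (ℚ.*-zeroˡ (f v)) (sym (ℚ.*-zeroʳ (f v)))
    ... | true  | false | true  = trans (ℚ.*-zeroʳ (w u)) (sym (ℚ.*-zeroˡ (w u)))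
    ... | false | false | true  = refl

    interior-comm : ∀ T w f → interior T w f ≡ interior T f w
    interior-comm T w f = begin
      Σℚ (λ u → restrict T w u * inflow T f u)
        ≡⟨ ℚΣ.sum-cong-≗ (λ u → ℚΣ.*-distribˡ-sum (restrict T w u) (restrict (A u) (restrict T f))) ⟩
      Σℚ (λ u → Σℚ (λ v → restrict T w u * restrict (A u) (restrict T f) v))
        ≡⟨ ℚΣ.∑-comm (λ u v → restrict T w u * restrict (A u) (restrict T f) v) ⟩
      Σℚ (λ v → Σℚ (λ u → restrict T w u * restrict (A u) (restrict T f) v))
        ≡⟨ ℚΣ.sum-cong-≗ (λ v → ℚΣ.sum-cong-≗ (λ u → edge-term-comm T w f u v)) ⟩
      Σℚ (λ v → Σℚ (λ u → restrict T f v * restrict (A v) (restrict T w) u))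
        ≡⟨ sym (ℚΣ.sum-cong-≗ (λ v → ℚΣ.*-distribˡ-sum (restrict T f v) (restrict (A v) (restrict T w)))) ⟩
      Σℚ (λ v → restrict T f v * inflow T w v) ∎
      where open ≡-Reasoning

    -- For null w and f both fluxes are minus the interior sum, which is symmetric in w and f.
    flux-comm : ∀ T {w f} → InNullSpace A w → InNullSpace A f → flux T w f ≡ flux T f w
    flux-comm T {w} {f} w-null f-null = ∙-cancelˡ (interior T w f) _ _ (begin
      interior T w f +ℚ flux T w f   ≡⟨ interior+flux T w f-null ⟩
      0ℚ                             ≡⟨ sym (interior+flux T f w-null) ⟩
      interior T f w +ℚ flux T f w   ≡⟨ cong (_+ℚ flux T f w) (sym (interior-comm T w f)) ⟩
      interior T w f +ℚ flux T f w   ∎)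
      where
      open ≡-Reasoning
      open GroupProperties ℚ.+-0-group using (∙-cancelˡ)

module _ {a} {X : Set a} where

  private
    length-fromList : ∀ {xs : List X} (u : Unique xs) → Fresh.length (Fresh.fromList u) ≡ length xs
    length-fromList []      = refl
    length-fromList (_ ∷ u) = cong suc (length-fromList u)

    ∈-fromList⁺ : ∀ {x : X} {xs} (u : Unique xs) → x ∈ xs → FreshAny.Any (x ≡_) (Fresh.fromList u)
    ∈-fromList⁺ (_ ∷ u) (here x≡y)  = FreshAny.here x≡y
    ∈-fromList⁺ (_ ∷ u) (there x∈xs) = FreshAny.there (∈-fromList⁺ u x∈xs)

    ∈-fromList⁻ : ∀ {x : X} {xs} (u : Unique xs) → FreshAny.Any (x ≡_) (Fresh.fromList u) → x ∈ xs
    ∈-fromList⁻ {xs = _ ∷ _} (_ ∷ u) (FreshAny.here x≡y)  = here x≡y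
    ∈-fromList⁻ {xs = _ ∷ _} (_ ∷ u) (FreshAny.there x∈xs) = there (∈-fromList⁻ u x∈xs)

  Unique-⊆⇒length≤ : ∀ {xs ys : List X} → Unique xs → Unique ys → All (_∈ ys) xs → length xs ≤ length ys
  Unique-⊆⇒length≤ xs-unique ys-unique xs⊆ys =
    subst₂ _≤_ (length-fromList xs-unique) (length-fromList ys-unique)
      (FreshMembership.injection (setoid X) (λ x≢y → x≢y)
        (∈-fromList⁺ ys-unique ∘ All.lookup xs⊆ys ∘ ∈-fromList⁻ xs-unique))

module _ {n : ℕ} where

  IsEndpointChoice : (Fin n × Fin n → Fin n) → Set
  IsEndpointChoice ch = ∀ u v → ch (u , v) ≡ u ⊎ ch (u , v) ≡ v

  choice-resp : ∀ {ch} → IsEndpointChoice ch → ∀ (P : Fin n → Set) {u v} → P u → P v → P (ch (u , v))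
  choice-resp ch-end P {u} {v} pu pv =
    [ (λ eq → subst P (sym eq) pu) , (λ eq → subst P (sym eq) pv) ] (ch-end u v)

  All-endpoints-choice : ∀ {ch} → IsEndpointChoice ch → ∀ {P : Fin n → Set} M →
                         All P (endpoints M) → All (P ∘ ch) M
  All-endpoints-choice ch-end []            []               = []
  All-endpoints-choice ch-end {P} ((u , v) ∷ M) (pu ∷ pv ∷ pM) =
    choice-resp ch-end P pu pv ∷ All-endpoints-choice ch-end M pM

  Unique-endpoints-choice : ∀ {ch} → IsEndpointChoice ch → ∀ M → Unique (endpoints M) → Unique (map ch M)
  Unique-endpoints-choice ch-end []            []                         = []
  Unique-endpoints-choice ch-end ((u , v) ∷ M) ((_ ∷ u∉M) ∷ v∉M ∷ M-unique) =
    All.map⁺ (All-endpoints-choice ch-end M (choice-resp ch-end (λ c → All (c ≢_) (endpoints M)) u∉M v∉M))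
    ∷ Unique-endpoints-choice ch-end M M-unique

  All-endpoints-graph : ∀ (f : Fin n → Fin n) {P : Fin n → Set} {xs} →
                        All (λ x → P x × P (f x)) xs → All P (endpoints (map (λ x → x , f x) xs))
  All-endpoints-graph f []               = []
  All-endpoints-graph f ((px , pfx) ∷ ps) = px ∷ pfx ∷ All-endpoints-graph f ps

  Unique-endpoints-graph : ∀ (f : Fin n → Fin n) {P : Fin n → Set} →
                           (∀ {x y} → P x → P y → x ≢ f y) → (∀ {x y} → P x → P y → f x ≡ f y → x ≡ y) →
                           ∀ {xs} → All P xs → Unique xs → Unique (endpoints (map (λ x → x , f x) xs))
  Unique-endpoints-graph f disjoint injective []         []              = []
  Unique-endpoints-graph f {P} disjoint injective {x ∷ _} (px ∷ pxs) (x∉xs ∷ xs-unique) =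
    (disjoint px px ∷ All-endpoints-graph f (All.zipWith x≢ (x∉xs , pxs)))
    ∷ All-endpoints-graph f (All.zipWith fx≢ (x∉xs , pxs))
    ∷ Unique-endpoints-graph f disjoint injective pxs xs-unique
    where
    x≢ : ∀ {y} → x ≢ y × P y → x ≢ y × x ≢ f y
    x≢ (x≢y , py) = x≢y , disjoint px py
    fx≢ : ∀ {y} → x ≢ y × P y → f x ≢ y × f x ≢ f y
    fx≢ (x≢y , py) = (λ fx≡y → disjoint py px (sym fx≡y)) , x≢y ∘ injective px py

  matching≤cover : ∀ {A : AdjMat n} {C : List (Fin n)} → Unique C → (∀ {u v} → GEdge A u v → u ∈ C ⊎ v ∈ C) →
                   ∀ {M} → IsMatching A M → length M ≤ length C
  matching≤cover {A} {C} C-unique C-covers {M} (M-edges , M-unique) = begin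
    length M            ≡⟨ sym (length-map pick M) ⟩
    length (map pick M) ≤⟨ Unique-⊆⇒length≤ (Unique-endpoints-choice pick-endpoint M M-unique) C-unique
                              (All.map⁺ (All.map pick-∈ M-edges)) ⟩
    length C            ∎
    where
    open ≤-Reasoning

    pick : Fin n × Fin n → Fin n
    pick (u , v) with member? _≟_ u C
    ... | yes _ = u
    ... | no  _ = v

    pick-endpoint : IsEndpointChoice pick
    pick-endpoint u v with member? _≟_ u C
    ... | yes _ = inj₁ refl
    ... | no  _ = inj₂ refl

    pick-∈ : ∀ {e} → GEdge A (proj₁ e) (proj₂ e) → pick e ∈ C
    pick-∈ {u , v} uv with member? _≟_ u C | C-covers uv
    ... | yes u∈C | _        = u∈C
    ... | no  u∉C | inj₁ u∈C = contradiction u∈C u∉C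
    ... | no  _   | inj₂ v∈C = v∈C

odd : ℕ → Bool
odd zero    = false
odd (suc k) = not (odd k)

module _ {n : ℕ} {A : AdjMat n} (ρ : Rooting A) where
  open Rooting ρ

  odd-depth-proper : ∀ b {u v} → GEdge A u v → odd (depth v) xor b ≡ not (odd (depth u) xor b)
  odd-depth-proper b {u} {v} e with edge-parent u v e
  ... | inj₁ pu rewrite parent-depth u v pu =
    trans (cong (_xor b) (sym (not-involutive (odd (depth v))))) (sym (not-distribˡ-xor (not (odd (depth v))) b))
  ... | inj₂ pv rewrite parent-depth v u pv = sym (not-distribˡ-xor (odd (depth u)) b)

  module Subtree (x : Fin n) where

    -- under u: x lies on the parent chain of u, which has at most depth u steps.
    under′ : ℕ → Fin n → Bool
    under′ zero    u = does (u ≟ x)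
    under′ (suc k) u = does (u ≟ x) ∨ maybe (under′ k) false (parent u)

    under : Fin n → Bool
    under u = under′ (depth u) u

    under-step : ∀ {u v} → parent u ≡ just v → under u ≡ does (u ≟ x) ∨ under v
    under-step {u} {v} pu rewrite parent-depth u v pu | pu = refl

    under-root : under x ≡ true
    under-root with depth x
    ... | zero  = dec-true (x ≟ x) refl
    ... | suc _ rewrite dec-true (x ≟ x) refl = refl

    under⇒depth≥ : ∀ k {u} → depth u ≡ k → under′ k u ≡ true → depth x ≤ depth u
    under⇒depth≥ zero {u} du tu with u ≟ x
    ... | yes refl = ℕ.≤-refl
    under⇒depth≥ (suc k) {u} du tu with u ≟ x | parent u in pu
    ... | yes refl | _      = ℕ.≤-refl
    ... | no _     | just v =
      subst (depth x ≤_) (sym (parent-depth u v pu)) (ℕ.m≤n⇒m≤1+n (under⇒depth≥ k dv tu))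
      where
      dv : depth v ≡ k
      dv = ℕ.suc-injective (trans (sym (parent-depth u v pu)) du)

    module _ {y : Fin n} (x↑y : parent x ≡ just y) where

      parent-not-under : under y ≡ false
      parent-not-under with under y in ty
      ... | false = refl
      ... | true  = ⊥-elim (ℕ.<⇒≱ (ℕ.≤-reflexive (sym (parent-depth x y x↑y))) (under⇒depth≥ (depth y) refl ty))

      leaving-edge : ∀ {u v} → under u ≡ true → under v ≡ false → Adj A u v → InS A v → u ≡ x × v ≡ y
      leaving-edge {u} {v} tu tv uv v∈S with edge-parent u v (uv , inj₂ v∈S)
      ... | inj₂ v↑u = contradiction
        (trans (sym tv) (trans (under-step v↑u) (trans (cong (does (v ≟ x) ∨_) tu) (∨-zeroʳ (does (v ≟ x))))))
        λ ()
      ... | inj₁ u↑v with u ≟ x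
      ...   | yes refl = refl , sym (just-injective (trans (sym x↑y) u↑v))
      ...   | no u≢x   = contradiction
        (trans (sym tu) (trans (under-step u↑v) (cong₂ _∨_ (dec-false (u ≟ x) u≢x) tv)))
        λ ()

      outflow-support : ∀ {f} → InNullSpace A f → ∀ {u} v → under u ≡ true →
                        restrict (A u) (restrict (not ∘ under) f) v ≢ 0ℚ → u ≡ x × v ≡ y
      outflow-support {f} f-null {u} v tu term≢0 with A u v in uv | under v in tv
      ... | true | false = leaving-edge tu tv uv (f , f-null , term≢0)
      ... | true | true  = ⊥-elim (term≢0 refl)
      ... | false | _    = ⊥-elim (term≢0 refl)

      outflow-root : ∀ {f} → InNullSpace A f → outflow A under f x ≡ f y
      outflow-root {f} f-null =
        trans (Σℚ-supported _ y (λ v → proj₂ ∘ outflow-support f-null v under-root)) at-y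
        where
        at-y : restrict (A x) (restrict (not ∘ under) f) y ≡ f y
        at-y rewrite proj₁ (parent-edge x y x↑y) | parent-not-under = refl

      outflow-off-root : ∀ {f} → InNullSpace A f → ∀ {u} → under u ≡ true → u ≢ x → outflow A under f u ≡ 0ℚ
      outflow-off-root {f} f-null {u} tu u≢x =
        Σℚ-zero (λ v → decidable-stable (_ ≟ℚ 0ℚ) (u≢x ∘ proj₁ ∘ outflow-support f-null v tu))

      flux-subtree : ∀ w {f} → InNullSpace A f → flux A under w f ≡ w x * f y
      flux-subtree w {f} f-null = trans (Σℚ-supported _ x supp) (cong₂ _*_ at-x (outflow-root f-null))
        where
        at-x : restrict under w x ≡ w x
        at-x rewrite under-root = refl
        supp : ∀ u → restrict under w u * outflow A under f u ≢ 0ℚ → u ≡ x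
        supp u term≢0 with u ≟ x | under u in tu
        ... | yes u≡x | _     = u≡x
        ... | no _    | false = ⊥-elim (term≢0 (ℚ.*-zeroˡ (outflow A under f u)))
        ... | no u≢x  | true  =
          ⊥-elim (term≢0 (trans (cong (w u *_) (outflow-off-root f-null tu u≢x)) (ℚ.*-zeroʳ (w u))))

module _ {n : ℕ} {A : AdjMat n} (A-sym : ∀ u v → A u v ≡ A v u) (ρ : Rooting A) where
  open Rooting ρ

  S-parent∉S : ∀ {x y} → parent x ≡ just y → InS A x → InS A y → ⊥
  S-parent∉S {x} {y} x↑y (z , z-null , zx≢0) (w , w-null , wy≢0) = *-≢0 zx≢0 wy≢0 (begin
    z x * w y            ≡⟨ cong (_* w y) (sym z′x≡zx) ⟩
    z′ x * w y           ≡⟨ sym (flux-subtree x↑y z′ w-null) ⟩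
    flux A under z′ w    ≡⟨ flux-comm A A-sym under z′-null w-null ⟩
    flux A under w z′    ≡⟨ flux-subtree x↑y w z′-null ⟩
    w x * z′ y           ≡⟨ cong (w x *_) z′y≡0 ⟩
    w x * 0ℚ             ≡⟨ ℚ.*-zeroʳ (w x) ⟩
    0ℚ                   ∎)
    where
    open ≡-Reasoning
    open Subtree ρ x

    colour : Fin n → Bool
    colour u = odd (depth u) xor odd (depth y)

    colour-y : colour y ≡ false
    colour-y = xor-same (odd (depth y))

    colour-x : colour x ≡ true
    colour-x = begin
      colour x             ≡⟨ sym (not-involutive (colour x)) ⟩
      not (not (colour x)) ≡⟨ cong not (sym (odd-depth-proper ρ (odd (depth y)) (parent-edge x y x↑y))) ⟩
      not (colour y)       ≡⟨ cong not colour-y ⟩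
      true                 ∎

    z′ : Fin n → ℚ
    z′ = restrict colour z

    -- Null vectors vanish off S and G-edges join consecutive depths, so z′ is again null.
    z′-null : InNullSpace A z′
    z′-null = restrict-colouring-null colour (odd-depth-proper ρ (odd (depth y))) z-null

    z′x≡zx : z′ x ≡ z x
    z′x≡zx rewrite colour-x = refl

    z′y≡0 : z′ y ≡ 0ℚ
    z′y≡0 rewrite colour-y = refl

  S-independent : ∀ {u v} → Adj A u v → InS A u → InS A v → ⊥
  S-independent {u} {v} uv u∈S v∈S with edge-parent u v (uv , inj₁ u∈S)
  ... | inj₁ u↑v = S-parent∉S u↑v u∈S v∈S
  ... | inj₂ v↑u = S-parent∉S v↑u v∈S u∈S

  GEdge-sym : ∀ {u v} → GEdge A u v → GEdge A v u
  GEdge-sym {u} {v} (uv , S-end) = trans (A-sym v u) uv , Sum.swap S-end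

  GEdge-meets-R : ∀ {u v} → GEdge A u v → InR A u ⊎ InR A v
  GEdge-meets-R uv@(adj , inj₁ u∈S) = inj₂ ((_ , GEdge-sym uv) , S-independent adj u∈S)
  GEdge-meets-R uv@(adj , inj₂ v∈S) = inj₁ ((_ , uv) , λ u∈S → S-independent adj u∈S v∈S)

  module _ {bb b : Fin n → ℕ} (bb-rec : IsBetaBar ρ bb) (b-rec : IsBeta ρ bb b) where

    Minimizer : Fin n → Fin n → Set
    Minimizer = BetaMinimizer ρ bb b

    minimizer-GEdge : ∀ {r s} → Minimizer r s → GEdge A r s
    minimizer-GEdge (inj₁ (s↑r , _)) = GEdge-sym (parent-edge _ _ s↑r)
    minimizer-GEdge (inj₂ (r↑s , _)) = parent-edge _ _ r↑s

    minimizer-∈S : ∀ {r s} → InR A r → Minimizer r s → InS A s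
    minimizer-∈S (_ , r∉S) m with minimizer-GEdge m
    ... | _ , inj₁ r∈S = contradiction r∈S r∉S
    ... | _ , inj₂ s∈S = s∈S

    β≤β̄ : ∀ {r} → InR A r → b r ≤ bb r
    β≤β̄ {r} r∈R rewrite proj₁ b-rec r r∈R = ℕ.m⊓n≤m (bb r) _

    β̄≤β : ∀ {s} → InVG A s → InS A s → bb s ≤ b s
    β̄≤β {s} s∈G s∈S rewrite proj₂ b-rec s s∈G s∈S = ℕ.m≤m+n (bb s) _

    β-S-parent : ∀ {s r} → InVG A s → InS A s → parent s ≡ just r → b s ≡ bb s + b r
    β-S-parent {s} s∈G s∈S s↑r rewrite proj₂ b-rec s s∈G s∈S | s↑r = refl

    childTerm : Fin n → Fin n → ℕ
    childTerm s c = if isChild ρ s c then bb c else 0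

    childTerm-child : ∀ {s c} → parent c ≡ just s → childTerm s c ≡ bb c
    childTerm-child {s} c↑s rewrite c↑s | dec-true (s ≟ s) refl = refl

    β̄-child< : ∀ {s c} → InVG A s → InS A s → parent c ≡ just s → bb c < bb s
    β̄-child< {s} {c} s∈G s∈S c↑s rewrite proj₂ bb-rec s s∈G s∈S =
      s≤s (subst (_≤ Σℕ (childTerm s)) (childTerm-child c↑s) (≤-Σℕ (childTerm s) c))

    β̄-children< : ∀ {s c c′} → InVG A s → InS A s → parent c ≡ just s → parent c′ ≡ just s → c ≢ c′ →
                  bb c + bb c′ < bb s
    β̄-children< {s} {c} {c′} s∈G s∈S c↑s c′↑s c≢c′ rewrite proj₂ bb-rec s s∈G s∈S =
      s≤s (subst (_≤ Σℕ (childTerm s)) (cong₂ _+_ (childTerm-child c↑s) (childTerm-child c′↑s))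
                 (+-≤-Σℕ (childTerm s) c≢c′))

    upward-minimizer-bound : ∀ {r s} → InR A r → b r ≡ b s ∸ bb r → b s ≤ bb r + bb r
    upward-minimizer-bound r∈R br≡ = m∸n≤n⇒m≤n+n (subst (_≤ _) br≡ (β≤β̄ r∈R))

    minimizer-injective : ∀ {r r′ s} → InR A r → InR A r′ → Minimizer r s → Minimizer r′ s → r ≡ r′
    minimizer-injective {r} {r′} {s} r∈R r′∈R m m′ = go m m′
      where
      s∈S : InS A s
      s∈S = minimizer-∈S r∈R m
      s∈G : InVG A s
      s∈G = r , GEdge-sym (minimizer-GEdge m)

      down-and-up : ∀ {a c} → InR A c → parent s ≡ just a → b a ≡ bb s → parent c ≡ just s → b c ≡ b s ∸ bb c → ⊥
      down-and-up {a} {c} c∈R s↑a ba≡ c↑s bc≡ = ℕ.<⇒≱ (begin-strict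
        bb c + bb c    <⟨ ℕ.+-mono-< (β̄-child< s∈G s∈S c↑s) (β̄-child< s∈G s∈S c↑s) ⟩
        bb s + bb s    ≡⟨ sym (trans (β-S-parent s∈G s∈S s↑a) (cong (bb s +_) ba≡)) ⟩
        b s            ∎) (upward-minimizer-bound c∈R bc≡)
        where open ≤-Reasoning

      smaller : ∀ {c c′} → InR A c → b c ≡ b s ∸ bb c → bb c + bb c′ < b s → bb c′ < bb c
      smaller {c} c∈R bc≡ lt = ℕ.+-cancelˡ-< (bb c) _ _ (ℕ.<-≤-trans lt (upward-minimizer-bound c∈R bc≡))

      go : Minimizer r s → Minimizer r′ s → r ≡ r′
      go (inj₁ (s↑r , _))   (inj₁ (s↑r′ , _))   = just-injective (trans (sym s↑r) s↑r′)
      go (inj₁ (s↑r , br))  (inj₂ (r′↑s , br′)) = ⊥-elim (down-and-up r′∈R s↑r br r′↑s br′)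
      go (inj₂ (r↑s , br))  (inj₁ (s↑r′ , br′)) = ⊥-elim (down-and-up r∈R s↑r′ br′ r↑s br)
      go (inj₂ (r↑s , br))  (inj₂ (r′↑s , br′)) with r ≟ r′
      ... | yes r≡r′ = r≡r′
      ... | no  r≢r′ = ⊥-elim (ℕ.<-asym (smaller r∈R br between)
                                         (smaller r′∈R br′ (subst (_< b s) (ℕ.+-comm (bb r) (bb r′)) between)))
        where
        between : bb r + bb r′ < b s
        between = ℕ.<-≤-trans (β̄-children< s∈G s∈S r↑s r′↑s r≢r′) (β̄≤β s∈G s∈S)

    module _ {φ : Fin n → Fin n} (φ-min : ∀ r → InR A r → Minimizer r (φ r)) where

      β-matching-isMatching : ∀ {rs} → All (InR A) rs → Unique rs → IsMatching A (map (λ r → r , φ r) rs)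
      β-matching-isMatching rs⊆R rs-unique =
        All.map⁺ (All.map (λ {r} r∈R → minimizer-GEdge (φ-min r r∈R)) rs⊆R) ,
        Unique-endpoints-graph φ R≢φR φ-injective rs⊆R rs-unique
        where
        R≢φR : ∀ {r r′} → InR A r → InR A r′ → r ≢ φ r′
        R≢φR (_ , r∉S) r′∈R refl = r∉S (minimizer-∈S r′∈R (φ-min _ r′∈R))
        φ-injective : ∀ {r r′} → InR A r → InR A r′ → φ r ≡ φ r′ → r ≡ r′
        φ-injective {r} {r′} r∈R r′∈R φr≡φr′ =
          minimizer-injective r∈R r′∈R (φ-min r r∈R) (subst (Minimizer r′) (sym φr≡φr′) (φ-min r′ r′∈R))

lemma12 : ∀ {n : ℕ} (A : AdjMat n) → IsForest A
    → (ρ : Rooting A)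
    → (bb b : Fin n → ℕ) → IsBetaBar ρ bb → IsBeta ρ bb b
    → (φ : Fin n → Fin n) → (∀ r → InR A r → BetaMinimizer ρ bb b r (φ r))
    → (Rs : List (Fin n)) → Unique Rs → (∀ x → (x ∈ Rs) ⇔ InR A x)
    → IsMaximumMatching A (map (λ r → r , φ r) Rs)
lemma12 A forest ρ bb b bb-rec b-rec φ φ-min Rs Rs-unique Rs⇔R =
  β-matching-isMatching A-sym ρ bb-rec b-rec φ-min (All.tabulate (Equivalence.to (Rs⇔R _))) Rs-unique ,
  λ M M-matching → subst (length M ≤_) (sym (length-map (λ r → r , φ r) Rs))
                         (matching≤cover Rs-unique R-covers M-matching)
  where
  A-sym : ∀ u v → A u v ≡ A v u
  A-sym = IsForest.symmetric forest

  R-covers : ∀ {u v} → GEdge A u v → u ∈ Rs ⊎ v ∈ Rs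
  R-covers = Sum.map (Equivalence.from (Rs⇔R _)) (Equivalence.from (Rs⇔R _)) ∘ GEdge-meets-R A-sym ρ
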